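{- Every finite-state middlebox has a symbolic representation, i.e., for every finite-state forwarding transducer there is a symbolic middlebox program whose denoted finite-state middlebox has the same forwarding behaviour (the same input/output language).
   Context: Fix a finite packet set $P$ and a finite port set $\mathsf{Pr}$. A (finite-state) middlebox is a transducer $(\Sigma,\Gamma,Q,q^0,\delta)$ with $\Sigma=P\times\mathsf{Pr}$, $\Gamma=2^{P\times\mathsf{Pr}}$, finite state set $Q$, initial state $q^0$, $\delta\subseteq Q\times\Sigma\times\Gamma\times Q$; if $\delta(q,(p,pr))=\emptyset$ the transition is undefined (the middlebox aborts). Its language consists of pairs (input sequence $h$, output sequence $\gamma$) such that $\gamma$ is producible along $h$ from $q^0$. A symbolic middlebox program uses finitely many relations over finite domains (packets fields, ports, and finitely many constants) with initial valuations; on input packet $(src,dst,tag)$ on port $prt$ it executes its main guarded command block. Guarded commands $grd\Rightarrow cmd$ have guards that are Boolean combinations (and, or, negated atoms) of atoms $e_1=e_2$ and $(e_1,\dots,e_n)~\mathbf{in}~R$ ($e_i$ constants or among $src,dst,tag,prt$); commands are $\mathbf{output}$ of a set of (packet, port) tuples, $\mathbf{abort}$ (transition undefined), $R.\mathbf{insert}~\bar e$, $R.\mathbf{remove}~\bar e$, sequential composition, or nested blocks. A block nondeterministically executes one command whose guard is true; if none is true, output is empty and no relation changes. Output is the union of all executed outputs. The program denotes the finite-state middlebox whose states are the valuations of its relations, with the initial valuation as initial state and transitions given by executing the main block. -}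

module Defs where

open import Data.Nat using (ℕ)
open import Data.Fin using (Fin; _≟_)
open import Data.Bool using (Bool; true; false; _∧_; _∨_; not; if_then_else_)
open import Data.List using (List; []; _∷_)
open import Data.List.Relation.Unary.All using (All; []; _∷_)
open import Data.List.Membership.Propositional using (_∈_)
open import Data.Vec using (Vec; replicate; zipWith; tabulate; lookup)
open import Data.Product using (_×_; _,_; proj₁; proj₂)
open import Relation.Nullary.Decidable using (⌊_⌋)
open import Relation.Binary.PropositionalEquality using (_≡_; refl)
open import Relation.Nullary using (yes; no)
open import Function.Bundles using (_⇔_)

-- Everything is parameterised by the finite packet/port universe:
--   hosts  Host = Fin nH   (values of the fields src and dst)
--   tags   Tag  = Fin nT   (values of the field tag)
--   ports  Port = Fin nPr
-- A packet is a triple (src , dst , tag); so P = Host × Host × Tag, Pr = Port.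
module Middleboxes (nH nT nPr : ℕ) where

  Host Tag Port : Set
  Host = Fin nH
  Tag  = Fin nT
  Port = Fin nPr

  Packet : Set
  Packet = Host × Host × Tag

  Inp : Set
  Inp = Packet × Port

  -- output alphabet Γ = 2^(P × Pr), as a (canonical) characteristic bit-array:
  -- (s , d , t , p) is in the set iff the bit at  s / d / t / p  is true.
  Out : Set
  Out = Vec (Vec (Vec (Vec Bool nPr) nT) nH) nH

  _∈ₒ_ : Packet × Port → Out → Bool
  ((s , d , t) , p) ∈ₒ o = lookup (lookup (lookup (lookup o s) d) t) p

  ∅ₒ : Out
  ∅ₒ = replicate nH (replicate nH (replicate nT (replicate nPr false)))

  _∪ₒ_ : Out → Out → Out
  _∪ₒ_ = zipWith (zipWith (zipWith (zipWith _∨_)))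

  ⁅_⁆ₒ : Packet × Port → Out
  ⁅ ((s , d , t) , p) ⁆ₒ =
    tabulate λ s' → tabulate λ d' → tabulate λ t' → tabulate λ p' →
      ⌊ s ≟ s' ⌋ ∧ ⌊ d ≟ d' ⌋ ∧ ⌊ t ≟ t' ⌋ ∧ ⌊ p ≟ p' ⌋

  record Transducer : Set₁ where
    field
      Q  : Set
      q0 : Q
      δ  : Q → Inp → Out → Q → Set

  data Run (T : Transducer) : Transducer.Q T → List Inp → List Out → Set where
    done : ∀ {q} → Run T q [] []
    step : ∀ {q σ g q' h γ} → Transducer.δ T q σ g q' →
           Run T q' h γ → Run T q (σ ∷ h) (g ∷ γ)

  Lang : Transducer → List Inp → List Out → Set
  Lang T h γ = Run T (Transducer.q0 T) h γ

  SameLanguage : Transducer → Transducer → Set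
  SameLanguage A B = ∀ h γ → Lang A h γ ⇔ Lang B h γ

  -- A finite-state middlebox: finite state set Fin nQ, initial state,
  -- and a finite transition relation δ ⊆ Q × Σ × Γ × Q (as characteristic
  -- function).  δ(q,σ) = ∅ means the middlebox aborts.
  record FiniteMiddlebox : Set where
    field
      nQ : ℕ
      q0 : Fin nQ
      δ  : Fin nQ → Inp → Out → Fin nQ → Bool

  fmbTransducer : FiniteMiddlebox → Transducer
  fmbTransducer M = record
    { Q  = Fin (FiniteMiddlebox.nQ M)
    ; q0 = FiniteMiddlebox.q0 M
    ; δ  = λ q σ g q' → FiniteMiddlebox.δ M q σ g q' ≡ true
    }

  data Sort : Set where
    sHost sTag sPort sConst : Sort

  module Syntax (nC : ℕ) where

    ⟦_⟧ : Sort → Set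
    ⟦ sHost ⟧  = Host
    ⟦ sTag ⟧   = Tag
    ⟦ sPort ⟧  = Port
    ⟦ sConst ⟧ = Fin nC

    eqV : ∀ s → ⟦ s ⟧ → ⟦ s ⟧ → Bool
    eqV sHost  a b = ⌊ a ≟ b ⌋
    eqV sTag   a b = ⌊ a ≟ b ⌋
    eqV sPort  a b = ⌊ a ≟ b ⌋
    eqV sConst a b = ⌊ a ≟ b ⌋

    Tuple : List Sort → Set
    Tuple = All ⟦_⟧

    eqT : ∀ {sig} → Tuple sig → Tuple sig → Bool
    eqT []               []               = true
    eqT (_∷_ {s} a as) (b ∷ bs) = eqV s a b ∧ eqT as bs

    data Expr : Sort → Set where
      val : ∀ {s} → ⟦ s ⟧ → Expr s
      src dst : Expr sHost
      tag : Expr sTag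
      prt : Expr sPort

    evalE : ∀ {s} → Inp → Expr s → ⟦ s ⟧
    evalE _ (val x) = x
    evalE ((s , d , t) , p) src = s
    evalE ((s , d , t) , p) dst = d
    evalE ((s , d , t) , p) tag = t
    evalE ((s , d , t) , p) prt = p

    evalEs : ∀ {sig} → Inp → All Expr sig → Tuple sig
    evalEs i []       = []
    evalEs i (e ∷ es) = evalE i e ∷ evalEs i es

    OutTuple : Set
    OutTuple = Expr sHost × Expr sHost × Expr sTag × Expr sPort

    evalOut : Inp → List OutTuple → Out
    evalOut i []                    = ∅ₒ
    evalOut i ((s , d , t , p) ∷ os) =
      ⁅ ((evalE i s , evalE i d , evalE i t) , evalE i p) ⁆ₒ ∪ₒ evalOut i os

    module Relations {nR : ℕ} (ar : Fin nR → List Sort) where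

      Valuation : Set
      Valuation = (r : Fin nR) → Tuple (ar r) → Bool

      data Atom : Set where
        eq  : ∀ {s} → Expr s → Expr s → Atom
        mem : (r : Fin nR) → All Expr (ar r) → Atom

      data Guard : Set where
        pos  : Atom → Guard
        neg  : Atom → Guard
        and  : Guard → Guard → Guard
        or   : Guard → Guard → Guard

      evalA : Inp → Valuation → Atom → Bool
      evalA i v (eq {s} a b) = eqV s (evalE i a) (evalE i b)
      evalA i v (mem r es)   = v r (evalEs i es)

      evalG : Inp → Valuation → Guard → Bool
      evalG i v (pos a)   = evalA i v a
      evalG i v (neg a)   = not (evalA i v a)
      evalG i v (and g h) = evalG i v g ∧ evalG i v h
      evalG i v (or g h)  = evalG i v g ∨ evalG i v h

      data Cmd : Set where
        output : List OutTuple → Cmd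
        abort  : Cmd
        insert : (r : Fin nR) → All Expr (ar r) → Cmd
        remove : (r : Fin nR) → All Expr (ar r) → Cmd
        _⨾_    : Cmd → Cmd → Cmd
        block  : List (Guard × Cmd) → Cmd

      update : Valuation → (r : Fin nR) → Tuple (ar r) → Bool → Valuation
      update v r t b r' t' with r ≟ r'
      ... | yes refl =
              if eqT t t' then b else v r t'
      ... | no _ = v r' t'

      -- big-step semantics: Exec i c v o v'  — on input i, command c run
      -- in valuation v can output o and end in valuation v'.
      -- abort has no derivation (the transition is undefined).
      data Exec (i : Inp) : Cmd → Valuation → Out → Valuation → Set where
        e-output : ∀ {os v} → Exec i (output os) v (evalOut i os) v
        e-insert : ∀ {r es v} →
                   Exec i (insert r es) v ∅ₒ (update v r (evalEs i es) true)
        e-remove : ∀ {r es v} →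
                   Exec i (remove r es) v ∅ₒ (update v r (evalEs i es) false)
        e-seq    : ∀ {c₁ c₂ v v₁ v₂ o₁ o₂} →
                   Exec i c₁ v o₁ v₁ → Exec i c₂ v₁ o₂ v₂ →
                   Exec i (c₁ ⨾ c₂) v (o₁ ∪ₒ o₂) v₂
        e-choose : ∀ {gcs g c v o v'} → (g , c) ∈ gcs →
                   evalG i v g ≡ true → Exec i c v o v' →
                   Exec i (block gcs) v o v'
        e-none   : ∀ {gcs v} →
                   All (λ gc → evalG i v (proj₁ gc) ≡ false) gcs →
                   Exec i (block gcs) v ∅ₒ v

  record Program : Set where
    field
      nC   : ℕ
      nR   : ℕ
      ar   : Fin nR → List Sort
      init : Syntax.Relations.Valuation nC ar
      main : Syntax.Relations.Cmd nC ar

  denote : Program → Transducer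
  denote P = record
    { Q  = Valuation
    ; q0 = init
    ; δ  = λ v σ g v' → Exec σ main v g v'
    }
    where open Program P
          open Syntax.Relations nC ar

module Submission where

-- A program stores the current state of the middlebox M in one unary relation over
-- constants naming the states of M.  Its main block has one branch per transition
-- (q , σ , g , q') of M; the branch is enabled exactly when q is the stored state and
-- the input is σ, and it replaces q by q' and outputs g, written out as the explicit
-- list of its members.  Transitions, inputs and outputs range over finite types, so
-- this block is a finite piece of syntax.  The valuations storing a single state are
-- then a bisimulation between M and the program, so the two have the same language.

open import Defs
open import Data.Nat using (ℕ; zero; suc)
open import Data.Bool using (Bool; true; false; _∧_; _∨_)
import Data.Bool as Bool
open import Data.Bool.Properties using (∨-zeroʳ; ∧-conicalˡ; ∧-conicalʳ; ⇔→≡)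
open import Data.Fin using (Fin; zero; _≟_)
open import Data.List using (List; []; _∷_; map; filter; cartesianProduct; cartesianProductWith; allFin)
open import Data.List.Relation.Unary.All using ([]; _∷_)
open import Data.List.Relation.Unary.Any using (here; there)
open import Data.List.Membership.Propositional using (_∈_)
open import Data.List.Membership.Propositional.Properties
  using (∈-allFin; ∈-cartesianProduct⁺; ∈-cartesianProductWith⁺; ∈-filter⁺; ∈-filter⁻; ∈-map⁺; ∈-map⁻)
open import Data.Product using (Σ-syntax; ∃-syntax; _×_; _,_; proj₂)
open import Data.Vec using (Vec; lookup)
import Data.Vec as Vec
open import Data.Vec.Properties using (lookup-zipWith; lookup-replicate; lookup∘tabulate)
open import Data.Vec.Relation.Binary.Pointwise.Extensional using (ext; Pointwise-≡⇒≡)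
open import Function.Base using (flip)
open import Function.Bundles using (_⇔_; mk⇔; Equivalence)
open import Relation.Binary.PropositionalEquality
  using (_≡_; refl; sym; trans; cong; subst; ≡-≟-identity; module ≡-Reasoning)
open import Relation.Nullary using (Dec; yes; no; contradiction)
open import Relation.Nullary.Decidable using (⌊_⌋)

record Listable (A : Set) : Set where
  field
    elements : List A
    complete : ∀ x → x ∈ elements

open Listable {{...}}

instance
  Fin-listable : ∀ {n} → Listable (Fin n)
  Fin-listable {n} = record { elements = allFin n ; complete = ∈-allFin }

  Bool-listable : Listable Bool
  Bool-listable = record { elements = true ∷ false ∷ [] ; complete = λ { true → here refl ; false → there (here refl) } }

  ×-listable : ∀ {A B : Set} {{_ : Listable A}} {{_ : Listable B}} → Listable (A × B)
  ×-listable = record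
    { elements = cartesianProduct elements elements
    ; complete = λ (a , b) → ∈-cartesianProduct⁺ (complete a) (complete b)
    }

  Vec-listable : ∀ {A : Set} {{_ : Listable A}} {n} → Listable (Vec A n)
  Vec-listable {A} = record { elements = vectors _ ; complete = vectors-complete }
    where
    vectors : ∀ n → List (Vec A n)
    vectors zero    = Vec.[] ∷ []
    vectors (suc n) = cartesianProductWith Vec._∷_ elements (vectors n)

    vectors-complete : ∀ {n} (xs : Vec A n) → xs ∈ vectors n
    vectors-complete Vec.[]       = here refl
    vectors-complete (x Vec.∷ xs) = ∈-cartesianProductWith⁺ Vec._∷_ (complete x) (vectors-complete xs)

⌊⌋-true⇔ : ∀ {A : Set} (a? : Dec A) → ⌊ a? ⌋ ≡ true ⇔ A
⌊⌋-true⇔ (yes a) = mk⇔ (λ _ → a) (λ _ → refl)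
⌊⌋-true⇔ (no ¬a) = mk⇔ (λ ()) (λ a → contradiction a ¬a)

module Construction (nH nT nPr : ℕ) where
  open Middleboxes nH nT nPr

  Simulation : (A B : Transducer) → (Transducer.Q A → Transducer.Q B → Set) → Set
  Simulation A B _∼_ = ∀ {a b σ g a'} → a ∼ b → Transducer.δ A a σ g a' →
                       ∃[ b' ] Transducer.δ B b σ g b' × a' ∼ b'

  run-simulate : ∀ {A B : Transducer} {_∼_} → Simulation A B _∼_ →
                 ∀ {a b h γ} → a ∼ b → Run A a h γ → Run B b h γ
  run-simulate sim a∼b done = done
  run-simulate sim a∼b (step a→a' run) with sim a∼b a→a'
  ... | b' , b→b' , a'∼b' = step b→b' (run-simulate sim a'∼b' run)

  bisimulation⇒sameLanguage : ∀ {A B : Transducer} {_∼_} →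
                              Transducer.q0 A ∼ Transducer.q0 B →
                              Simulation A B _∼_ → Simulation B A (flip _∼_) →
                              SameLanguage A B
  bisimulation⇒sameLanguage init forth back h γ =
    mk⇔ (run-simulate forth init) (run-simulate back init)

  Out-ext : ∀ {a b : Out} → (∀ Y → Y ∈ₒ a ≡ Y ∈ₒ b) → a ≡ b
  Out-ext a≈b = vec-ext λ s → vec-ext λ d → vec-ext λ t → vec-ext λ p → a≈b ((s , d , t) , p)
    where
    vec-ext : ∀ {A : Set} {n} {xs ys : Vec A n} → (∀ i → lookup xs i ≡ lookup ys i) → xs ≡ ys
    vec-ext pointwise = Pointwise-≡⇒≡ (ext pointwise)

  ∈ₒ-∅ₒ : ∀ Y → Y ∈ₒ ∅ₒ ≡ false
  ∈ₒ-∅ₒ ((s , d , t) , p)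
    rewrite lookup-replicate s (Vec.replicate nH (Vec.replicate nT (Vec.replicate nPr false)))
          | lookup-replicate d (Vec.replicate nT (Vec.replicate nPr false))
          | lookup-replicate t (Vec.replicate nPr false)
          = lookup-replicate p false

  ∈ₒ-∪ₒ : ∀ Y a b → Y ∈ₒ (a ∪ₒ b) ≡ (Y ∈ₒ a) ∨ (Y ∈ₒ b)
  ∈ₒ-∪ₒ ((s , d , t) , p) a b
    rewrite lookup-zipWith (Vec.zipWith (Vec.zipWith (Vec.zipWith _∨_))) s a b
          | lookup-zipWith (Vec.zipWith (Vec.zipWith _∨_)) d (lookup a s) (lookup b s)
          | lookup-zipWith (Vec.zipWith _∨_) t (lookup (lookup a s) d) (lookup (lookup b s) d)
          = lookup-zipWith _∨_ p (lookup (lookup (lookup a s) d) t) (lookup (lookup (lookup b s) d) t)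

  ∪ₒ-identityˡ : ∀ a → ∅ₒ ∪ₒ a ≡ a
  ∪ₒ-identityˡ a = Out-ext λ Y → trans (∈ₒ-∪ₒ Y ∅ₒ a) (cong (_∨ (Y ∈ₒ a)) (∈ₒ-∅ₒ Y))

  _≡ᵇ_ : Inp → Inp → Bool
  ((s , d , t) , p) ≡ᵇ ((s' , d' , t') , p') = ⌊ s ≟ s' ⌋ ∧ ⌊ d ≟ d' ⌋ ∧ ⌊ t ≟ t' ⌋ ∧ ⌊ p ≟ p' ⌋

  ≡ᵇ⇒≡ : ∀ X Y → X ≡ᵇ Y ≡ true → X ≡ Y
  ≡ᵇ⇒≡ ((s , d , t) , p) ((s' , d' , t') , p') X≡ᵇY with s ≟ s' | d ≟ d' | t ≟ t' | p ≟ p' | X≡ᵇY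
  ... | yes refl | yes refl | yes refl | yes refl | _  = refl
  ... | no _     | _        | _        | _        | ()
  ... | yes _    | no _     | _        | _        | ()
  ... | yes _    | yes _    | no _     | _        | ()
  ... | yes _    | yes _    | yes _    | no _     | ()

  ≡ᵇ-refl : ∀ X → X ≡ᵇ X ≡ true
  ≡ᵇ-refl ((s , d , t) , p)
    rewrite ≡-≟-identity _≟_ {s} refl | ≡-≟-identity _≟_ {d} refl
          | ≡-≟-identity _≟_ {t} refl | ≡-≟-identity _≟_ {p} refl = refl

  ∈ₒ-⁅⁆ₒ : ∀ X Y → Y ∈ₒ ⁅ X ⁆ₒ ≡ X ≡ᵇ Y
  ∈ₒ-⁅⁆ₒ X@((s , d , t) , p) ((s' , d' , t') , p')
    rewrite lookup∘tabulate (λ s' → Vec.tabulate λ d' → Vec.tabulate λ t' → Vec.tabulate λ p' →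
                               X ≡ᵇ ((s' , d' , t') , p')) s'
          | lookup∘tabulate (λ d' → Vec.tabulate λ t' → Vec.tabulate λ p' →
                               X ≡ᵇ ((s' , d' , t') , p')) d'
          | lookup∘tabulate (λ t' → Vec.tabulate λ p' → X ≡ᵇ ((s' , d' , t') , p')) t'
          = lookup∘tabulate (λ p' → X ≡ᵇ ((s' , d' , t') , p')) p'

  module OutputLiterals (nC : ℕ) where
    open Syntax nC

    literal : Inp → OutTuple
    literal ((s , d , t) , p) = val s , val d , val t , val p

    ∈ₒ-evalOut-literals⁻ : ∀ i Y xs → Y ∈ₒ evalOut i (map literal xs) ≡ true → Y ∈ xs
    ∈ₒ-evalOut-literals⁻ i Y [] Y∈
      with () ← trans (sym (∈ₒ-∅ₒ Y)) Y∈
    ∈ₒ-evalOut-literals⁻ i Y (X@((_ , _ , _) , _) ∷ xs) Y∈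
      rewrite ∈ₒ-∪ₒ Y ⁅ X ⁆ₒ (evalOut i (map literal xs)) | ∈ₒ-⁅⁆ₒ X Y
      with X ≡ᵇ Y in X≡ᵇY
    ... | true  = here (sym (≡ᵇ⇒≡ X Y X≡ᵇY))
    ... | false = there (∈ₒ-evalOut-literals⁻ i Y xs Y∈)

    ∈ₒ-evalOut-literals⁺ : ∀ i Y xs → Y ∈ xs → Y ∈ₒ evalOut i (map literal xs) ≡ true
    ∈ₒ-evalOut-literals⁺ i Y (X@((_ , _ , _) , _) ∷ xs) (here refl)
      rewrite ∈ₒ-∪ₒ Y ⁅ X ⁆ₒ (evalOut i (map literal xs)) | ∈ₒ-⁅⁆ₒ X Y | ≡ᵇ-refl Y = refl
    ∈ₒ-evalOut-literals⁺ i Y (X@((_ , _ , _) , _) ∷ xs) (there Y∈xs)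
      rewrite ∈ₒ-∪ₒ Y ⁅ X ⁆ₒ (evalOut i (map literal xs)) | ∈ₒ-evalOut-literals⁺ i Y xs Y∈xs
      = ∨-zeroʳ (Y ∈ₒ ⁅ X ⁆ₒ)

    members : Out → List Inp
    members g = filter (λ X → (X ∈ₒ g) Bool.≟ true) elements

    evalOut-members : ∀ i g → evalOut i (map literal (members g)) ≡ g
    evalOut-members i g = Out-ext λ Y → ⇔→≡ (mk⇔
      (λ Y∈ → proj₂ (∈-filter⁻ (λ X → (X ∈ₒ g) Bool.≟ true) {xs = elements}
                       (∈ₒ-evalOut-literals⁻ i Y (members g) Y∈)))
      (λ Y∈g → ∈ₒ-evalOut-literals⁺ i Y (members g)
                 (∈-filter⁺ (λ X → (X ∈ₒ g) Bool.≟ true) (complete Y) Y∈g)))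

  module Symbolic (M : FiniteMiddlebox) where
    open FiniteMiddlebox M
    open Syntax nQ
    open OutputLiterals nQ

    arity : Fin 1 → List Sort
    arity _ = sConst ∷ []

    open Relations arity

    current : Fin 1
    current = zero

    Encodes : Fin nQ → Valuation → Set
    Encodes q v = ∀ c → v current (c ∷ []) ≡ ⌊ c ≟ q ⌋

    initial : Valuation
    initial _ (c ∷ []) = ⌊ c ≟ q0 ⌋

    moveTo : Fin nQ → Fin nQ → Valuation → Valuation
    moveTo q q' v = update (update v current (q ∷ []) false) current (q' ∷ []) true

    Encodes-moveTo : ∀ {q v} q' → Encodes q v → Encodes q' (moveTo q q' v)
    Encodes-moveTo {q} q' enc c with q' ≟ c | c ≟ q'
    ... | yes refl | yes _    = refl
    ... | yes refl | no c≢c   = contradiction refl c≢c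
    ... | no q'≢c  | yes c≡q' = contradiction (sym c≡q') q'≢c
    ... | no _     | no _ with q ≟ c | c ≟ q | enc c
    ...   | yes refl | _       | _ = refl
    ...   | no q≢c   | yes c≡q | _ = contradiction (sym c≡q) q≢c
    ...   | no _     | no _    | e = e

    inputIs : Inp → Guard
    inputIs ((s , d , t) , p) =
      and (pos (eq src (val s))) (and (pos (eq dst (val d))) (and (pos (eq tag (val t))) (pos (eq prt (val p)))))

    evalG-inputIs : ∀ i v σ → evalG i v (inputIs σ) ≡ i ≡ᵇ σ
    evalG-inputIs ((_ , _ , _) , _) v ((_ , _ , _) , _) = refl

    always : Guard
    always = pos (eq prt prt)

    evalG-always : ∀ i v → evalG i v always ≡ true
    evalG-always ((_ , _ , _) , p) v = Equivalence.from (⌊⌋-true⇔ (p ≟ p)) refl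

    Transition : Set
    Transition = Fin nQ × Inp × Out × Fin nQ

    transitions : List Transition
    transitions = filter (λ (q , σ , g , q') → δ q σ g q' Bool.≟ true) elements

    branch : Transition → Guard × Cmd
    branch (q , σ , g , q') =
      and (pos (mem current (val q ∷ []))) (inputIs σ) ,
      (remove current (val q ∷ []) ⨾ (insert current (val q' ∷ []) ⨾ output (map literal (members g))))

    -- The aborting branch is always enabled, so the block can never take its silent
    -- "no guard holds" step: where M has no transition, the program has none either.
    mainBlock : Cmd
    mainBlock = block ((always , abort) ∷ map branch transitions)

    program : Program
    program = record { nC = nQ ; nR = 1 ; ar = arity ; init = initial ; main = mainBlock }

    branch-output : ∀ i g → ∅ₒ ∪ₒ (∅ₒ ∪ₒ evalOut i (map literal (members g))) ≡ g
    branch-output i g = begin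
      ∅ₒ ∪ₒ (∅ₒ ∪ₒ evalOut i (map literal (members g))) ≡⟨ ∪ₒ-identityˡ _ ⟩
      ∅ₒ ∪ₒ evalOut i (map literal (members g))         ≡⟨ ∪ₒ-identityˡ _ ⟩
      evalOut i (map literal (members g))               ≡⟨ evalOut-members i g ⟩
      g                                                 ∎
      where open ≡-Reasoning

    step-complete : Simulation (fmbTransducer M) (denote program) Encodes
    step-complete {q} {v} {σ} {g} {q'} enc δ≡true =
      moveTo q q' v ,
      subst (λ o → Exec σ mainBlock v o (moveTo q q' v)) (branch-output σ g)
        (e-choose (there (∈-map⁺ branch (∈-filter⁺ _ (complete (q , σ , g , q')) δ≡true)))
          enabled (e-seq e-remove (e-seq e-insert e-output))) ,
      Encodes-moveTo {v = v} q' enc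
      where
      enabled : v current (q ∷ []) ∧ evalG σ v (inputIs σ) ≡ true
      enabled rewrite enc q | ≡-≟-identity _≟_ {q} refl | evalG-inputIs σ v σ | ≡ᵇ-refl σ = refl

    step-sound : Simulation (denote program) (fmbTransducer M) (flip Encodes)
    step-sound {v} {q} {σ} enc (e-none (always-false ∷ _))
      with () ← trans (sym always-false) (evalG-always σ v)
    step-sound enc (e-choose (here refl) _ ())
    step-sound {v} {q} {σ} enc (e-choose (there b∈) enabled exec) with ∈-map⁻ branch b∈
    ... | (q₁ , σ₁ , g , q') , t∈ , refl with exec
    ...   | e-seq e-remove (e-seq e-insert e-output)
      with Equivalence.to (⌊⌋-true⇔ (q₁ ≟ q))
             (trans (sym (enc q₁)) (∧-conicalˡ (v current (q₁ ∷ [])) _ enabled))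
         | ≡ᵇ⇒≡ σ σ₁ (trans (sym (evalG-inputIs σ v σ₁)) (∧-conicalʳ (v current (q₁ ∷ [])) _ enabled))
    ...   | refl | refl =
      q' , subst (λ o → δ q σ o q' ≡ true) (sym (branch-output σ g)) (proj₂ (∈-filter⁻ _ {xs = elements} t∈)) ,
      Encodes-moveTo {v = v} q' enc

lemma1 : (nH nT nPr : ℕ) → let open Middleboxes nH nT nPr in
    (M : FiniteMiddlebox) →
    Σ[ prog ∈ Program ] SameLanguage (fmbTransducer M) (denote prog)
lemma1 nH nT nPr M =
  program , bisimulation⇒sameLanguage (λ _ → refl) step-complete step-sound
  where
  open Construction nH nT nPr
  open Symbolic M
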